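{- Let $D,A$ be sets, $v:\mathbb{X}\to\mathsf{R}(D,A)$ a valuation, $t$ a lattice term built from variables using $\wedge$ and $\vee$ only, and $f\in D^A$ with $f\in[\![t]\!]_v$. Let $T(f,t)$ be any set obtained by the recursive construction described in the context. Then for every $T\subseteq D^A$ with $T(f,t)\subseteq T$, $f\in[\![t]\!]_{v_T}$.
   Context: $D^A$ is the set of functions $A\to D$, $\delta(f,g)=\{a\in A\mid f(a)\neq g(a)\}$, $\overline{X}^{\alpha}=\{g\in D^A\mid\exists f\in X,\ \delta(f,g)\subseteq\alpha\}$, $X$ is $\alpha$-closed if $X=\overline{X}^{\alpha}$. $\mathsf{R}(D,A)$ is the complete lattice of pairs $(\alpha,X)$, $\alpha\subseteq A$, $X\subseteq D^A$ $\alpha$-closed, ordered componentwise, meets componentwise intersection, $\bigvee_i(\alpha_i,X_i)=(\bigcup\alpha_i,\overline{\bigcup X_i}^{\bigcup\alpha_i})$. For a pair $(\alpha,X)$ and $f\in D^A$, $f\in(\alpha,X)$ means $f\in X$. For $T\subseteq D^A$ let $\mathrm{int}_T(\alpha,X)=(\alpha,\overline{X\cap T}^{\alpha})$; $\mathsf{R}(D,A)_T$ is the set of pairs $\mathrm{int}_T(\alpha,X)$, $\alpha\subseteq A$, $X\subseteq D^A$, a complete lattice with joins as in $\mathsf{R}(D,A)$ and meets $\bigwedge^T_i(\alpha_i,X_i)=\mathrm{int}_T(\bigcap\alpha_i,\bigcap X_i)$. The valuation $v_T:\mathbb{X}\to\mathsf{R}(D,A)_T$ is $v_T(x)=\mathrm{int}_T(v(x))$;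 $[\![t]\!]_{v_T}$ is the value of $t$ in $\mathsf{R}(D,A)_T$ and $[\![t]\!]_v$ in $\mathsf{R}(D,A)$. For each such term $t$ and $f\in[\![t]\!]_v$, $T(f,t)\subseteq D^A$ is defined recursively: $T(f,x)=\{f\}$ for a variable $x$; $T(f,s_1\wedge s_2)=T(f,s_1)\cup T(f,s_2)$; for $t=s_1\vee s_2$ with $[\![s_i]\!]_v=(\alpha_i,X_i)$, choose $i\in\{1,2\}$ and $g\in X_i$ with $\delta(f,g)\subseteq\alpha_1\cup\alpha_2$ and set $T(f,t)=\{f\}\cup T(g,s_i)$. -}

module Defs where

open import Data.Product using (Σ; _×_; _,_; proj₁; proj₂)
open import Data.Sum using (_⊎_)
open import Relation.Binary.PropositionalEquality using (_≡_)
open import Relation.Nullary using (¬_)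

Subset : Set → Set₁
Subset X = X → Set

_⊆_ : {X : Set} → Subset X → Subset X → Set
P ⊆ Q = ∀ x → P x → Q x

_∪_ : {X : Set} → Subset X → Subset X → Subset X
(P ∪ Q) x = P x ⊎ Q x

_∩_ : {X : Set} → Subset X → Subset X → Subset X
(P ∩ Q) x = P x × Q x

δ : {D A : Set} → (A → D) → (A → D) → Subset A
δ f g a = ¬ (f a ≡ g a)

closure : {D A : Set} → Subset A → Subset (A → D) → Subset (A → D)
closure {D} {A} α X g = Σ (A → D) λ f → X f × (δ f g ⊆ α)

-- Elements of R(D,A): pairs (α , X) with X α-closed (X = closure α X;
-- the inclusion X ⊆ closure α X holds automatically, so we record the other one).
record R (D A : Set) : Set₁ where
  field
    α      : Subset A
    X      : Subset (A → D)
    closed : closure α X ⊆ X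

Pair : Set → Set → Set₁
Pair D A = Subset A × Subset (A → D)

joinP : {D A : Set} → Pair D A → Pair D A → Pair D A
joinP (α₁ , X₁) (α₂ , X₂) = (α₁ ∪ α₂) , closure (α₁ ∪ α₂) (X₁ ∪ X₂)

meetP : {D A : Set} → Pair D A → Pair D A → Pair D A
meetP (α₁ , X₁) (α₂ , X₂) = (α₁ ∩ α₂) , (X₁ ∩ X₂)

intT : {D A : Set} → Subset (A → D) → Pair D A → Pair D A
intT T (α , X) = α , closure α (X ∩ T)

_∈P_ : {D A : Set} → (A → D) → Pair D A → Set
f ∈P P = proj₂ P f

data Term (𝕏 : Set) : Set where
  var  : 𝕏 → Term 𝕏
  _∧ₜ_ : Term 𝕏 → Term 𝕏 → Term 𝕏
  _∨ₜ_ : Term 𝕏 → Term 𝕏 → Term 𝕏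

⟦_⟧ : {D A 𝕏 : Set} → Term 𝕏 → (𝕏 → R D A) → Pair D A
⟦ var x ⟧ v = R.α (v x) , R.X (v x)
⟦ s₁ ∧ₜ s₂ ⟧ v = meetP (⟦ s₁ ⟧ v) (⟦ s₂ ⟧ v)
⟦ s₁ ∨ₜ s₂ ⟧ v = joinP (⟦ s₁ ⟧ v) (⟦ s₂ ⟧ v)

-- Value ⟦t⟧_{v_T} in R(D,A)_T, where v_T(x) = int_T(v x):
-- joins as in R(D,A), meets are int_T of componentwise intersections.
⟦_⟧[_] : {D A 𝕏 : Set} → Term 𝕏 → Subset (A → D) → (𝕏 → R D A) → Pair D A
⟦ var x ⟧[ T ] v = intT T (⟦ var x ⟧ v)
⟦ s₁ ∧ₜ s₂ ⟧[ T ] v = intT T (meetP (⟦ s₁ ⟧[ T ] v) (⟦ s₂ ⟧[ T ] v))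
⟦ s₁ ∨ₜ s₂ ⟧[ T ] v = joinP (⟦ s₁ ⟧[ T ] v) (⟦ s₂ ⟧[ T ] v)

-- IsTfun v f t S : S is one of the sets T(f,t) produced by the recursive
-- construction (the choices in the ∨ case are the constructor arguments).
data IsTfun {D A 𝕏 : Set} (v : 𝕏 → R D A) :
       (A → D) → Term 𝕏 → Subset (A → D) → Set₁ where
  tvar  : ∀ f x → IsTfun v f (var x) (λ h → h ≡ f)
  tmeet : ∀ f s₁ s₂ S₁ S₂ →
          IsTfun v f s₁ S₁ → IsTfun v f s₂ S₂ →
          IsTfun v f (s₁ ∧ₜ s₂) (S₁ ∪ S₂)
  tjoin₁ : ∀ f s₁ s₂ g S →
           g ∈P ⟦ s₁ ⟧ v →
           δ f g ⊆ (proj₁ (⟦ s₁ ⟧ v) ∪ proj₁ (⟦ s₂ ⟧ v)) →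
           IsTfun v g s₁ S →
           IsTfun v f (s₁ ∨ₜ s₂) ((λ h → h ≡ f) ∪ S)
  tjoin₂ : ∀ f s₁ s₂ g S →
           g ∈P ⟦ s₂ ⟧ v →
           δ f g ⊆ (proj₁ (⟦ s₁ ⟧ v) ∪ proj₁ (⟦ s₂ ⟧ v)) →
           IsTfun v g s₂ S →
           IsTfun v f (s₁ ∨ₜ s₂) ((λ h → h ≡ f) ∪ S)

-- A variable value int_T(v x) keeps f because
-- f ∈ T; a meet keeps f in both arguments and f ∈ T, so f survives the outer int_T; in a
-- join f is recovered from the chosen g ∈ X_i, since the α-components only grow from
-- ⟦t⟧_v to ⟦t⟧_{v_T} and so δ(f,g) stays inside the α of the join.
module Submission where

open import Defs
open import Data.Product using (_,_; proj₁)
open import Data.Sum using (_⊎_; inj₁; inj₂; [_,_])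
open import Data.Empty using (⊥-elim)
open import Function using (_∘_)
open import Relation.Binary.PropositionalEquality using (refl; sym)

⊆-trans : {X : Set} {P Q S : Subset X} → P ⊆ Q → Q ⊆ S → P ⊆ S
⊆-trans P⊆Q Q⊆S x = Q⊆S x ∘ P⊆Q x

∪-mono : {X : Set} {P P′ Q Q′ : Subset X} → P ⊆ P′ → Q ⊆ Q′ → (P ∪ Q) ⊆ (P′ ∪ Q′)
∪-mono P⊆P′ Q⊆Q′ x = [ (λ p → inj₁ (P⊆P′ x p)) , (λ q → inj₂ (Q⊆Q′ x q)) ]

∪-⊆ˡ : {X : Set} {P Q S : Subset X} → (P ∪ Q) ⊆ S → P ⊆ S
∪-⊆ˡ P∪Q⊆S x p = P∪Q⊆S x (inj₁ p)

∪-⊆ʳ : {X : Set} {P Q S : Subset X} → (P ∪ Q) ⊆ S → Q ⊆ S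
∪-⊆ʳ P∪Q⊆S x q = P∪Q⊆S x (inj₂ q)

δ-sym : {D A : Set} {f g : A → D} {α : Subset A} → δ f g ⊆ α → δ g f ⊆ α
δ-sym δfg⊆α a g≢f = δfg⊆α a (λ f≡g → g≢f (sym f≡g))

∈-closure : {D A : Set} {α : Subset A} {X : Subset (A → D)} {f : A → D} →
            X f → closure α X f
∈-closure {f = f} fX = f , fX , λ a f≢f → ⊥-elim (f≢f refl)

module _ {D A 𝕏 : Set} (v : 𝕏 → R D A) where

  IsTfun-∋ : ∀ {f t S} → IsTfun v f t S → S f
  IsTfun-∋ (tvar _ _)               = refl
  IsTfun-∋ (tmeet _ _ _ _ _ p _)    = inj₁ (IsTfun-∋ p)
  IsTfun-∋ (tjoin₁ _ _ _ _ _ _ _ _) = inj₁ refl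
  IsTfun-∋ (tjoin₂ _ _ _ _ _ _ _ _) = inj₁ refl

  module _ (T : Subset (A → D)) where

    α-⟦⟧⊆α-⟦⟧[] : (t : Term 𝕏) → proj₁ (⟦ t ⟧ v) ⊆ proj₁ (⟦ t ⟧[ T ] v)
    α-⟦⟧⊆α-⟦⟧[] (var x)    = λ _ a∈α → a∈α
    α-⟦⟧⊆α-⟦⟧[] (s₁ ∧ₜ s₂) = λ a → λ { (a∈α₁ , a∈α₂) →
      α-⟦⟧⊆α-⟦⟧[] s₁ a a∈α₁ , α-⟦⟧⊆α-⟦⟧[] s₂ a a∈α₂ }
    α-⟦⟧⊆α-⟦⟧[] (s₁ ∨ₜ s₂) = ∪-mono (α-⟦⟧⊆α-⟦⟧[] s₁) (α-⟦⟧⊆α-⟦⟧[] s₂)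

    join-∋ : ∀ s₁ s₂ {f g} →
             δ f g ⊆ (proj₁ (⟦ s₁ ⟧ v) ∪ proj₁ (⟦ s₂ ⟧ v)) →
             (g ∈P ⟦ s₁ ⟧[ T ] v) ⊎ (g ∈P ⟦ s₂ ⟧[ T ] v) →
             f ∈P ⟦ s₁ ∨ₜ s₂ ⟧[ T ] v
    join-∋ s₁ s₂ {g = g} δfg⊆α g∈ =
      g , g∈ , ⊆-trans (δ-sym δfg⊆α) (∪-mono (α-⟦⟧⊆α-⟦⟧[] s₁) (α-⟦⟧⊆α-⟦⟧[] s₂))

    ∈⟦⟧[] : ∀ t f → f ∈P ⟦ t ⟧ v → (S : Subset (A → D)) → IsTfun v f t S → S ⊆ T →
            f ∈P ⟦ t ⟧[ T ] v
    ∈⟦⟧[] _ f f∈ _ (tvar _ _) S⊆T = ∈-closure (f∈ , S⊆T f refl)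
    ∈⟦⟧[] _ f (f∈₁ , f∈₂) _ (tmeet _ s₁ s₂ S₁ S₂ p₁ p₂) S⊆T =
      ∈-closure ( ( ∈⟦⟧[] s₁ f f∈₁ S₁ p₁ (∪-⊆ˡ S⊆T)
                  , ∈⟦⟧[] s₂ f f∈₂ S₂ p₂ (∪-⊆ʳ S⊆T) )
                , S⊆T f (inj₁ (IsTfun-∋ p₁)) )
    ∈⟦⟧[] _ _ _ _ (tjoin₁ _ s₁ s₂ g S g∈ δfg⊆α p) S⊆T =
      join-∋ s₁ s₂ δfg⊆α (inj₁ (∈⟦⟧[] s₁ g g∈ S p (∪-⊆ʳ S⊆T)))
    ∈⟦⟧[] _ _ _ _ (tjoin₂ _ s₁ s₂ g S g∈ δfg⊆α p) S⊆T =
      join-∋ s₁ s₂ δfg⊆α (inj₂ (∈⟦⟧[] s₂ g g∈ S p (∪-⊆ʳ S⊆T)))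

mainTheorem7 : (D A 𝕏 : Set) (v : 𝕏 → R D A) (t : Term 𝕏) (f : A → D) →
    f ∈P ⟦ t ⟧ v →
    (Tf : Subset (A → D)) → IsTfun v f t Tf →
    (T : Subset (A → D)) → Tf ⊆ T →
    f ∈P ⟦ t ⟧[ T ] v
mainTheorem7 D A 𝕏 v t f f∈ Tf isTf T Tf⊆T = ∈⟦⟧[] v T t f f∈ Tf isTf Tf⊆T
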